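{- Let $S$ be a strongly connected component of the pair-digraph $G^+$ and $S'=\{(u,v):(v,u)\in S\}$ its coupled component. If both envelopes $N^*[S]$ and $N^*[S']$ contain a circuit, then $G$ is not an interval $k$-graph.
   Context: $G$ is a graph with a given partition of $V(G)$ into independent sets (partite sets) $V_1,\dots,V_k$; $c(u)$ denotes the index of the partite set containing $u$. $G$ is an interval $k$-graph if there are real intervals $I_v$, $v\in V(G)$, such that for $u,v$ in different partite sets, $uv\in E(G)$ iff $I_u\cap I_v\neq\emptyset$. Let $\bar E=\{uv: u\in V_i, v\in V_j, i\neq j\}\setminus E(G)$. The pair-digraph $G^+$ has vertex set all ordered pairs $(u,v)$ with $u\ne v$ in $V(G)$, and arcs: (i) $(u,v)\to(u',v)$ whenever $c(u)=c(v)$, $uu'\in E(G)$, $vu'\notin E(G)$; (ii) $(u,v)\to(u',v)$ whenever $uu'\in E(G)$, $u'v\in\bar E$, and $u,v,u'$ lie in three different partite sets; (iii) $(u,v)\to(u,v')$ whenever $c(u)=c(v')$, $vv'\in E(G)$, $uv\notin E(G)$; (iv) $(u,v)\to(u,v')$ whenever $vv'\in E(G)$, $uv\in\bar E$, and $u,v,v'$ lie in three different partite sets. For a set $R$ of pairs, the envelope $N^*[R]$ is the smallest set of pairs containing $R$ that is closed under reachability in $G^+$ (every pair reachable by a directed path from a pair in the set is in the set) and under transitivity (if $(u,v),(v,w)$ are in the set then so is $(u,w)$). For $n\ge1$, a circuit in a set $D$ of pairs is a sequence $(x_0,x_1),(x_1,x_2),\dots,(x_{n-1},x_n),(x_n,x_0)$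 of pairs all in $D$. -}

module Defs where

open import Level using (0ℓ)
open import Data.Nat using (ℕ; zero; suc)
open import Data.Fin using (Fin; zero; suc; inject₁; fromℕ)
open import Data.Bool using (Bool; true; false)
open import Data.Product using (Σ; ∃; ∃-syntax; _×_; _,_)
open import Relation.Binary.PropositionalEquality using (_≡_; _≢_)
open import Relation.Binary.Bundles using (TotalOrder)
open import Function.Bundles using (_⇔_)

-- A finite simple graph on vertex set Fin n together with a partition of the
-- vertices into k independent sets (partite sets) V_0,...,V_{k-1};
-- col u is the index c(u) of the partite set containing u.
record PartGraph : Set where
  field
    n     : ℕ
    k     : ℕ
    col   : Fin n → Fin k
    adj   : Fin n → Fin n → Bool
    sym   : ∀ u v → adj u v ≡ adj v u
    irrefl : ∀ u → adj u u ≡ false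
    indep : ∀ u v → adj u v ≡ true → col u ≢ col v

module _ (G : PartGraph) where
  open PartGraph G

  V : Set
  V = Fin n

  E : V → V → Set
  E u v = adj u v ≡ true

  Ebar : V → V → Set
  Ebar u v = (col u ≢ col v) × (adj u v ≡ false)

  Three : V → V → V → Set
  Three u v w = (col u ≢ col v) × (col v ≢ col w) × (col u ≢ col w)

  data RawArc : V → V → V → V → Set where
    arc-i   : ∀ {u v u'} → col u ≡ col v → E u u' → adj v u' ≡ false
            → RawArc u v u' v
    arc-ii  : ∀ {u v u'} → E u u' → Ebar u' v → Three u v u'
            → RawArc u v u' v
    arc-iii : ∀ {u v v'} → col u ≡ col v' → E v v' → adj u v ≡ false
            → RawArc u v u v'
    arc-iv  : ∀ {u v v'} → E v v' → Ebar u v → Three u v v'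
            → RawArc u v u v'

  -- Arcs of G⁺: the vertices of G⁺ are ordered pairs of distinct vertices.
  Arc : V → V → V → V → Set
  Arc u v u' v' = (u ≢ v) × (u' ≢ v') × RawArc u v u' v'

  data Reach : V → V → V → V → Set where
    here : ∀ {u v} → Reach u v u v
    step : ∀ {u v u' v' u'' v''} → Arc u v u' v' → Reach u' v' u'' v''
         → Reach u v u'' v''

  PairSet : Set₁
  PairSet = V → V → Set

  IsSCC : PairSet → Set
  IsSCC S = Σ V λ a → Σ V λ b → (a ≢ b) ×
            (∀ u v → S u v ⇔ (Reach a b u v × Reach u v a b))

  coupled : PairSet → PairSet
  coupled S u v = S v u

  data Env (R : PairSet) : PairSet where
    base  : ∀ {u v} → R u v → Env R u v
    reach : ∀ {u v u' v'} → Env R u v → Arc u v u' v' → Env R u' v'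
    trans : ∀ {u v w} → Env R u v → Env R v w → u ≢ w → Env R u w

  -- D contains a circuit (x_0,x_1),...,(x_{m-1},x_m),(x_m,x_0) with m ≥ 1;
  -- here m = suc m' and x : Fin (suc m) → V lists x_0,...,x_m.
  HasCircuit : PairSet → Set
  HasCircuit D = Σ ℕ λ m' → Σ (Fin (suc (suc m')) → V) λ x →
                 (∀ (i : Fin (suc m')) → D (x (inject₁ i)) (x (suc i)))
                 × D (x (fromℕ (suc m'))) (x zero)

  IsIntervalKGraphIn : TotalOrder 0ℓ 0ℓ 0ℓ → Set
  IsIntervalKGraphIn O =
    Σ (V → Carrier) λ l → Σ (V → Carrier) λ r →
      (∀ v → l v ≤ r v) ×
      (∀ u v → col u ≢ col v → (E u v ⇔ ((l u ≤ r v) × (l v ≤ r u))))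
    where open TotalOrder O using (Carrier; _≤_)

{-# OPTIONS --safe #-}
module Submission where

open import Defs
open import Level using (0ℓ)
open import Relation.Nullary using (¬_)
open import Relation.Binary.Bundles using (TotalOrder)
open import Data.Nat using (ℕ; zero; suc)
open import Data.Fin using (Fin; zero; suc; inject₁; fromℕ; _<_)
open import Data.Fin.Properties using (<-cmp; <-irrefl; <-trans)
open import Data.Product using (Σ; _×_; _,_; proj₁; proj₂)
open import Data.Sum using (_⊎_; inj₁; inj₂)
open import Data.Bool using (false)
open import Data.Empty using (⊥; ⊥-elim)
open import Function.Bundles using (_⇔_; Equivalence)
open import Relation.Binary.Core using (Rel)
open import Relation.Binary.Definitions using (Transitive; tri<; tri≈; tri>)
open import Relation.Binary.PropositionalEquality as ≡ using (_≡_; _≢_; ≢-sym)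
open import Relation.Nullary.Decidable.Core using (yes; no; ¬¬-excluded-middle)

-- Proof idea: given an interval representation, order the vertices by the
-- right ends of their intervals, breaking ties by index.  Every arc of G⁺ maps
-- a pair (u,v) with u ≺ v to another such pair: for an arc (u,v) → (u',v) the
-- interval of u' meets that of u but misses that of v, so it ends before v
-- does (symmetrically for arcs moving v).  Since (u,v) ↦ (v,u) reverses the
-- arcs of G⁺, S is reachable from some (a,b) and S' from (b,a).  Whichever of
-- the two is increasing makes S or S', and then its envelope, increasing,
-- and an increasing set of pairs contains no circuit.

module _ {A : Set} {_∼_ : Rel A 0ℓ} (∼-trans : Transitive _∼_) where

  chain⇒first∼last : (m : ℕ) (x : Fin (suc (suc m)) → A) →
                     (∀ i → x (inject₁ i) ∼ x (suc i)) → x zero ∼ x (fromℕ (suc m))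
  chain⇒first∼last zero    x links = links zero
  chain⇒first∼last (suc m) x links =
    ∼-trans (chain⇒first∼last m (λ i → x (inject₁ i)) (λ i → links (inject₁ i)))
            (links (fromℕ (suc m)))

module _ (G : PartGraph) where
  open PartGraph G using () renaming (sym to adj-sym)

  private
    variable
      u v u' v' a b : V G

  E-sym : E G u v → E G v u
  E-sym {u} {v} uv = ≡.trans (adj-sym v u) uv

  RawArc-coupled : RawArc G u v u' v' → RawArc G v' u' v u
  RawArc-coupled (arc-i cuv uu' vu'∉E) = arc-iii (≡.sym cuv) (E-sym uu') vu'∉E
  RawArc-coupled {u} {v} {u'} (arc-ii uu' (cu'v , u'v∉E) (cuv , cvu' , cuu')) =
    arc-iv (E-sym uu') (≢-sym cu'v , ≡.trans (adj-sym v u') u'v∉E)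
           (cvu' , ≢-sym cuu' , ≢-sym cuv)
  RawArc-coupled (arc-iii cuv' vv' uv∉E) = arc-i (≡.sym cuv') (E-sym vv') uv∉E
  RawArc-coupled {u} {v} (arc-iv vv' (cuv , uv∉E) (_ , cvv' , cuv')) =
    arc-ii (E-sym vv') (≢-sym cuv , ≡.trans (adj-sym v u) uv∉E)
           (≢-sym cuv' , cuv , ≢-sym cvv')

  Arc-coupled : Arc G u v u' v' → Arc G v' u' v u
  Arc-coupled (u≢v , u'≢v' , arc) = ≢-sym u'≢v' , ≢-sym u≢v , RawArc-coupled arc

  Reach-snoc : Reach G u v u' v' → Arc G u' v' a b → Reach G u v a b
  Reach-snoc here           last = step last here
  Reach-snoc (step first p) last = step first (Reach-snoc p last)

  Reach-coupled : Reach G u v u' v' → Reach G v' u' v u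
  Reach-coupled here         = here
  Reach-coupled (step arc p) = Reach-snoc (Reach-coupled p) (Arc-coupled arc)

  SCC⇒reachable : (S : PairSet G) → IsSCC G S →
                  Σ (V G) λ a → Σ (V G) λ b → a ≢ b ×
                  (∀ {u v} → S u v → Reach G a b u v) ×
                  (∀ {u v} → coupled G S u v → Reach G b a u v)
  SCC⇒reachable S (a , b , a≢b , S⇔) =
    a , b , a≢b , (λ s → proj₁ (to s)) , (λ s → Reach-coupled (proj₂ (to s)))
    where
    to : ∀ {u v} → S u v → Reach G a b u v × Reach G u v a b
    to {u} {v} = Equivalence.to (S⇔ u v)

module IntervalOrder (G : PartGraph) (O : TotalOrder 0ℓ 0ℓ 0ℓ)
                     (rep : IsIntervalKGraphIn G O) where
  open PartGraph G using (col; adj; indep) renaming (sym to adj-sym)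
  open TotalOrder O using (_≤_; total) renaming (refl to ≤-refl; trans to ≤-trans)

  private
    variable
      u v u' v' : V G

  l r : V G → TotalOrder.Carrier O
  l = proj₁ rep
  r = proj₁ (proj₂ rep)

  l≤r : ∀ v → l v ≤ r v
  l≤r = proj₁ (proj₂ (proj₂ rep))

  E⇔meet : ∀ u v → col u ≢ col v → E G u v ⇔ ((l u ≤ r v) × (l v ≤ r u))
  E⇔meet = proj₂ (proj₂ (proj₂ rep))

  meet : E G u v → l u ≤ r v
  meet {u} {v} uv = proj₁ (Equivalence.to (E⇔meet u v (indep u v uv)) uv)

  disjoint : col u ≢ col v → adj u v ≡ false → l u ≤ r v → l v ≤ r u → ⊥
  disjoint {u} {v} cuv uv∉E lu≤rv lv≤ru
    with ≡.trans (≡.sym uv∉E) (Equivalence.from (E⇔meet u v cuv) (lu≤rv , lv≤ru))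
  ... | ()

  _≺_ : Rel (V G) 0ℓ
  u ≺ v = (r u ≤ r v) × (r v ≤ r u → u < v)

  ≺-irrefl : ¬ (u ≺ u)
  ≺-irrefl (_ , tie) = <-irrefl ≡.refl (tie ≤-refl)

  ≺-trans : Transitive _≺_
  ≺-trans (ru≤rv , tie₁) (rv≤rw , tie₂) =
    ≤-trans ru≤rv rv≤rw ,
    λ rw≤ru → <-trans (tie₁ (≤-trans rv≤rw rw≤ru)) (tie₂ (≤-trans rw≤ru ru≤rv))

  ≰⇒≺ : ¬ (r v ≤ r u) → u ≺ v
  ≰⇒≺ {v} {u} rv≰ru with total (r u) (r v)
  ... | inj₁ ru≤rv = ru≤rv , λ rv≤ru → ⊥-elim (rv≰ru rv≤ru)
  ... | inj₂ rv≤ru = ⊥-elim (rv≰ru rv≤ru)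

  ≺-connex-tie : u ≢ v → r u ≤ r v → r v ≤ r u → u ≺ v ⊎ v ≺ u
  ≺-connex-tie {u} {v} u≢v ru≤rv rv≤ru with <-cmp u v
  ... | tri< u<v _ _ = inj₁ (ru≤rv , λ _ → u<v)
  ... | tri≈ _ u≡v _ = ⊥-elim (u≢v u≡v)
  ... | tri> _ _ v<u = inj₂ (rv≤ru , λ _ → v<u)

  -- Totality of ≤ cannot tell whether two right ends coincide, so connexity
  -- of the tie-broken order only holds up to double negation.
  ≺-connex : u ≢ v → ¬ ¬ (u ≺ v ⊎ v ≺ u)
  ≺-connex u≢v k = ¬¬-excluded-middle λ where
    (no rv≰ru)  → k (inj₁ (≰⇒≺ rv≰ru))
    (yes rv≤ru) → ¬¬-excluded-middle λ where
      (no ru≰rv)  → k (inj₂ (≰⇒≺ ru≰rv))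
      (yes ru≤rv) → k (≺-connex-tie u≢v ru≤rv rv≤ru)

  ≺-moveˡ : E G u u' → col u' ≢ col v → adj u' v ≡ false → r u ≤ r v → u' ≺ v
  ≺-moveˡ uu' cu'v u'v∉E ru≤rv = ≰⇒≺ λ rv≤ru' →
    disjoint cu'v u'v∉E (≤-trans (meet (E-sym G uu')) ru≤rv) (≤-trans (l≤r _) rv≤ru')

  ≺-moveʳ : E G v v' → col u ≢ col v → adj u v ≡ false → r u ≤ r v → u ≺ v'
  ≺-moveʳ vv' cuv uv∉E ru≤rv = ≰⇒≺ λ rv'≤ru →
    disjoint cuv uv∉E (≤-trans (l≤r _) ru≤rv) (≤-trans (meet vv') rv'≤ru)

  RawArc-≺ : RawArc G u v u' v' → u ≺ v → u' ≺ v'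
  RawArc-≺ {u} {v} {u'} (arc-i cuv uu' vu'∉E) (ru≤rv , _) =
    ≺-moveˡ uu' (λ cu'≡cv → indep u u' uu' (≡.trans cuv (≡.sym cu'≡cv)))
            (≡.trans (adj-sym u' v) vu'∉E) ru≤rv
  RawArc-≺ (arc-ii uu' (cu'v , u'v∉E) _) (ru≤rv , _) = ≺-moveˡ uu' cu'v u'v∉E ru≤rv
  RawArc-≺ {u} {v} {_} {v'} (arc-iii cuv' vv' uv∉E) (ru≤rv , _) =
    ≺-moveʳ vv' (λ cu≡cv → indep v v' vv' (≡.trans (≡.sym cu≡cv) cuv')) uv∉E ru≤rv
  RawArc-≺ (arc-iv vv' (cuv , uv∉E) _) (ru≤rv , _) = ≺-moveʳ vv' cuv uv∉E ru≤rv

  Reach-≺ : Reach G u v u' v' → u ≺ v → u' ≺ v'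
  Reach-≺ here                   u≺v = u≺v
  Reach-≺ (step (_ , _ , arc) p) u≺v = Reach-≺ p (RawArc-≺ arc u≺v)

  Increasing : PairSet G → Set
  Increasing D = ∀ {u v} → D u v → u ≺ v

  Env-increasing : ∀ {R} → Increasing R → Increasing (Env G R)
  Env-increasing R↑ (base x)              = R↑ x
  Env-increasing R↑ (reach e (_ , _ , a)) = RawArc-≺ a (Env-increasing R↑ e)
  Env-increasing R↑ (trans e f _)         =
    ≺-trans (Env-increasing R↑ e) (Env-increasing R↑ f)

  increasing⇒¬circuit : ∀ {D} → Increasing D → ¬ HasCircuit G D
  increasing⇒¬circuit D↑ (m , x , links , closing) =
    ≺-irrefl (≺-trans first≺last (D↑ closing))
    where
    first≺last : x zero ≺ x (fromℕ (suc m))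
    first≺last = chain⇒first∼last {_∼_ = _≺_} ≺-trans m x (λ i → D↑ (links i))

lemma5 : (G : PartGraph) (S : PairSet G) → IsSCC G S
       → HasCircuit G (Env G S) → HasCircuit G (Env G (coupled G S))
       → (O : TotalOrder 0ℓ 0ℓ 0ℓ) → ¬ IsIntervalKGraphIn G O
lemma5 G S S-scc circuit circuit′ O rep with SCC⇒reachable G S S-scc
... | a , b , a≢b , S⊆ , S′⊆ = ≺-connex a≢b λ where
    (inj₁ a≺b) → increasing⇒¬circuit (Env-increasing λ s → Reach-≺ (S⊆ s) a≺b) circuit
    (inj₂ b≺a) → increasing⇒¬circuit (Env-increasing λ s → Reach-≺ (S′⊆ s) b≺a) circuit′
  where open IntervalOrder G O rep
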